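{- Let $S$ be a string of length $n$ over an alphabet $\Sigma$ and $Q\subseteq\Sigma$ with $|Q|\ge2$. Let $[s_1,t_1],\ldots,[s_{\mu},t_{\mu}]$ be the minimal co-occurrences of $Q$ in $S$, where $t_1 < \ldots < t_{\mu}$, and let $t_{\mu+1} = n+1$. Then (a) there are no left-minimal co-occurrences that end at an index $k < t_1$, and (b) for each index $k$ with $t_i \leq k < t_{i+1}$ for some $i\in[1,\mu]$, the left-minimal co-occurrence ending at $k$ starts at $s_i$.
   Context: An interval $[i,j]\subseteq[1,n]$ is a co-occurrence of $Q$ in $S$ if $S[i..j]$ contains each character of $Q$ at least once. It is left-minimal if $[i+1,j]$ is not a co-occurrence, and minimal if neither $[i+1,j]$ nor $[i,j-1]$ is a co-occurrence. At most one minimal co-occurrence ends at any given index, so the ordering by right endpoints is unique (if $\mu=0$ the convention gives $t_1=n+1$). -}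

module Defs where

open import Data.Nat using (ℕ; suc; _≤_; _∸_)
open import Data.Fin using (Fin; toℕ)
open import Data.Vec using (Vec; lookup)
open import Data.List using (List)
open import Data.List.Membership.Propositional using (_∈_)
open import Data.Product using (Σ; ∃; _×_)
open import Relation.Binary.PropositionalEquality using (_≡_)
open import Relation.Nullary using (¬_)

-- Strings are vectors; positions are 1-based natural numbers.
-- S has character c at (1-based) position p.
At : ∀ {a} {A : Set a} {n : ℕ} → Vec A n → ℕ → A → Set a
At {n = n} S p c = Σ (Fin n) λ f → (suc (toℕ f) ≡ p) × (lookup S f ≡ c)

CoOcc : ∀ {a} {A : Set a} {n : ℕ} → Vec A n → List A → ℕ → ℕ → Set a
CoOcc {n = n} S Q i j =
  (1 ≤ i) × (i ≤ j) × (j ≤ n) ×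
  (∀ c → c ∈ Q → ∃ λ p → (i ≤ p) × (p ≤ j) × At S p c)

LeftMinimal : ∀ {a} {A : Set a} {n : ℕ} → Vec A n → List A → ℕ → ℕ → Set a
LeftMinimal S Q i j = CoOcc S Q i j × ¬ CoOcc S Q (suc i) j

Minimal : ∀ {a} {A : Set a} {n : ℕ} → Vec A n → List A → ℕ → ℕ → Set a
Minimal S Q i j = CoOcc S Q i j × ¬ CoOcc S Q (suc i) j × ¬ CoOcc S Q i (j ∸ 1)

-- Every co-occurrence contains a minimal one; since CoOcc is not decidable without
-- decidable equality on the alphabet, this holds only under a double negation, which
-- suffices because it is only used to refute co-occurrences.
-- For t_i ≤ k < t_(i+1), every minimal co-occurrence inside [s_i + 1, k] ends at some
-- t_j ≤ t_i, hence lies inside [s_i + 1, t_i], contradicting minimality of [s_i, t_i];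
-- so [s_i, k] is left-minimal, and left-minimal co-occurrences ending at k are unique.
-- For k < t_1 no minimal co-occurrence fits inside any [a, k].
module Submission where

open import Defs
open import Data.Nat using (ℕ; zero; suc; _≤_; _<_; _∸_; pred; z≤n; s≤s; _≤?_)
open import Data.Nat.Properties
open import Data.Vec using (Vec)
open import Data.List using (List; length)
open import Data.List.Relation.Unary.Unique.Propositional using (Unique)
open import Data.Product using (∃; ∃₂; _×_; _,_; proj₁)
open import Data.Empty using (⊥)
open import Data.Sum using (inj₁; inj₂)
open import Relation.Binary using (tri<; tri≈; tri>)
open import Relation.Binary.PropositionalEquality using (_≡_; refl)
open import Relation.Nullary using (¬_; yes; no; contradiction)
open import Relation.Nullary.Decidable using (¬¬-excluded-middle)

stepwise-mono : ∀ (f : ℕ → ℕ) {lo hi} → (∀ i → lo ≤ i → i < hi → f i < f (suc i)) →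
  ∀ {i j} → lo ≤ i → i ≤ j → j ≤ hi → f i ≤ f j
stepwise-mono f step {j = zero} _ z≤n _ = ≤-refl
stepwise-mono f step {i} {suc j} lo≤i i≤j+1 j+1≤hi with m≤n⇒m<n∨m≡n i≤j+1
... | inj₂ refl = ≤-refl
... | inj₁ (s≤s i≤j) =
  ≤-trans (stepwise-mono f step lo≤i i≤j (<⇒≤ j+1≤hi))
          (<⇒≤ (step j (≤-trans lo≤i i≤j) j+1≤hi))

module _ {A : Set} {n : ℕ} (S : Vec A n) (Q : List A) where

  coOcc-widen : ∀ {a b a′ b′} → CoOcc S Q a b →
    1 ≤ a′ → a′ ≤ a → b ≤ b′ → b′ ≤ n → CoOcc S Q a′ b′
  coOcc-widen (_ , a≤b , _ , occ) 1≤a′ a′≤a b≤b′ b′≤n =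
    1≤a′ , ≤-trans a′≤a (≤-trans a≤b b≤b′) , b′≤n ,
    λ c c∈Q → let (p , a≤p , p≤b , at) = occ c c∈Q
              in p , ≤-trans a′≤a a≤p , ≤-trans p≤b b≤b′ , at

  coOcc-shrinkˡ : ∀ {a b a′} → CoOcc S Q a′ b → a < a′ → CoOcc S Q (suc a) b
  coOcc-shrinkˡ c@(_ , _ , b≤n , _) a<a′ = coOcc-widen c (s≤s z≤n) a<a′ ≤-refl b≤n

  MinimalWithin : ℕ → ℕ → Set
  MinimalWithin a b = ∃₂ λ a′ b′ → a ≤ a′ × b′ ≤ b × Minimal S Q a′ b′

  coOcc⇒¬¬minimalWithin : ∀ {a b} → CoOcc S Q a b → ¬ ¬ MinimalWithin a b
  coOcc⇒¬¬minimalWithin {a} {b} = shrink (suc (b ∸ a)) ≤-refl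
    where
    pred< : ∀ {m} → 1 ≤ pred m → pred m < m
    pred< {suc m} _ = ≤-refl

    shrink : ∀ d {a b} → b ∸ a < d → CoOcc S Q a b → ¬ ¬ MinimalWithin a b
    shrink (suc d) {a} {b} width c none = ¬¬-excluded-middle {A = CoOcc S Q (suc a) b} λ where
      (yes cˡ@(_ , a<b , _)) → shrink d (≤-trans (∸-monoʳ-< (n<1+n a) a<b) (≤-pred width)) cˡ
        λ (a′ , b′ , a<a′ , b′≤b , m) → none (a′ , b′ , <⇒≤ a<a′ , b′≤b , m)
      (no ¬cˡ) → ¬¬-excluded-middle {A = CoOcc S Q a (b ∸ 1)} λ where
        (yes cʳ@(1≤a , a≤b-1 , _)) →
          shrink d (≤-trans (∸-monoˡ-< (pred< (≤-trans 1≤a a≤b-1)) a≤b-1) (≤-pred width)) cʳ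
            λ (a′ , b′ , a≤a′ , b′≤b-1 , m) → none (a′ , b′ , a≤a′ , ≤-trans b′≤b-1 (m∸n≤m b 1) , m)
        (no ¬cʳ) → none (a , b , ≤-refl , ≤-refl , c , ¬cˡ , ¬cʳ)

  leftMinimal-unique : ∀ {a a′ k} → LeftMinimal S Q a k → LeftMinimal S Q a′ k → a ≡ a′
  leftMinimal-unique {a} {a′} (c , ¬cˡ) (c′ , ¬c′ˡ) with <-cmp a a′
  ... | tri≈ _ a≡a′ _ = a≡a′
  ... | tri< a<a′ _ _ = contradiction (coOcc-shrinkˡ c′ a<a′) ¬cˡ
  ... | tri> _ _ a′<a = contradiction (coOcc-shrinkˡ c a′<a) ¬c′ˡ

  minimal-extends-leftMinimal : ∀ {s t k} → Minimal S Q s t → t ≤ k → k ≤ n →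
    (∀ a′ b′ → Minimal S Q a′ b′ → b′ ≤ k → b′ ≤ t) → LeftMinimal S Q s k
  minimal-extends-leftMinimal {s} {t} {k} (c@(_ , _ , t≤n , _) , ¬cˡ , _) t≤k k≤n ends≤t =
    coOcc-widen c (proj₁ c) ≤-refl t≤k k≤n , ¬cˡk
    where
    ¬cˡk : ¬ CoOcc S Q (suc s) k
    ¬cˡk cˡk = coOcc⇒¬¬minimalWithin cˡk λ (a′ , b′ , s<a′ , b′≤k , m@(c′ , _)) →
      ¬cˡ (coOcc-widen c′ (s≤s z≤n) s<a′ (ends≤t a′ b′ m b′≤k) t≤n)

lemma1 : {A : Set} (n : ℕ) (S : Vec A n) (Q : List A) →
    Unique Q → 2 ≤ length Q →
    (μ : ℕ) (s t : ℕ → ℕ) →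
    (∀ i → 1 ≤ i → i ≤ μ → Minimal S Q (s i) (t i)) →
    (∀ a b → Minimal S Q a b → ∃ λ i → (1 ≤ i) × (i ≤ μ) × (s i ≡ a) × (t i ≡ b)) →
    (∀ i → 1 ≤ i → i < μ → t i < t (suc i)) →
    t (suc μ) ≡ suc n →
    (∀ a k → k < t 1 → ¬ LeftMinimal S Q a k) ×
    (∀ i k → 1 ≤ i → i ≤ μ → t i ≤ k → k < t (suc i) →
    LeftMinimal S Q (s i) k × (∀ a → LeftMinimal S Q a k → a ≡ s i))
lemma1 n S Q _ _ μ s t minimal enumerated increasing t-last = partA , partB
  where
  t-mono : ∀ {i j} → 1 ≤ i → i ≤ j → j ≤ μ → t i ≤ t j
  t-mono = stepwise-mono t increasing

  partA : ∀ a k → k < t 1 → ¬ LeftMinimal S Q a k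
  partA a k k<t₁ (c , _) = coOcc⇒¬¬minimalWithin S Q c λ (a′ , b′ , _ , b′≤k , m) →
    end≥t₁ a′ b′ m b′≤k
    where
    end≥t₁ : ∀ a′ b′ → Minimal S Q a′ b′ → b′ ≤ k → ⊥
    end≥t₁ a′ b′ m b′≤k with enumerated a′ b′ m
    ... | j , 1≤j , j≤μ , _ , refl = <⇒≱ k<t₁ (≤-trans (t-mono ≤-refl 1≤j j≤μ) b′≤k)

  partB : ∀ i k → 1 ≤ i → i ≤ μ → t i ≤ k → k < t (suc i) →
    LeftMinimal S Q (s i) k × (∀ a → LeftMinimal S Q a k → a ≡ s i)
  partB i k 1≤i i≤μ tᵢ≤k k<tᵢ₊₁ = leftMinimal , λ a lm → leftMinimal-unique S Q lm leftMinimal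
    where
    tᵢ₊₁≤n+1 : t (suc i) ≤ suc n
    tᵢ₊₁≤n+1 with m≤n⇒m<n∨m≡n i≤μ
    ... | inj₁ i<μ = let (_ , _ , t≤n , _) , _ = minimal (suc i) (s≤s z≤n) i<μ in m≤n⇒m≤1+n t≤n
    ... | inj₂ refl = ≤-reflexive t-last

    ends≤tᵢ : ∀ a′ b′ → Minimal S Q a′ b′ → b′ ≤ k → b′ ≤ t i
    ends≤tᵢ a′ b′ m b′≤k with enumerated a′ b′ m
    ... | j , 1≤j , j≤μ , _ , refl with j ≤? i
    ...   | yes j≤i = t-mono 1≤j j≤i i≤μ
    ...   | no j≰i = contradiction (≤-trans (t-mono (s≤s z≤n) (≰⇒> j≰i) j≤μ) b′≤k) (<⇒≱ k<tᵢ₊₁)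

    leftMinimal : LeftMinimal S Q (s i) k
    leftMinimal = minimal-extends-leftMinimal S Q (minimal i 1≤i i≤μ) tᵢ≤k
      (≤-pred (≤-trans k<tᵢ₊₁ tᵢ₊₁≤n+1)) ends≤tᵢ
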